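{- Let $G$ be a connected graph with at least two vertices. Then $\eta_p(G)=2$ if and only if $G$ is isomorphic to $K_2$.
   Context: Graphs are finite, simple, undirected and connected. For $v\in V(G)$ and $S\subseteq V(G)$, $d(v,S)=\min\{d(v,w):w\in S\}$. For a partition $\Pi=\{S_1,\dots,S_k\}$ of $V(G)$, $r(u|\Pi)=(d(u,S_1),\dots,d(u,S_k))$; $\Pi$ is resolving if $r(u|\Pi)\ne r(v|\Pi)$ for all distinct $u,v$, and dominating if each vertex $v$ has $d(v,S_j)=1$ for some $j$. $\eta_p(G)$ is the minimum cardinality of a partition that is both resolving and dominating. -}

module Defs where

open import Data.Nat using (ℕ; zero; suc; _≤_)
open import Data.Fin using (Fin)
open import Data.Product using (Σ; ∃; ∃-syntax; _×_; _,_)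
open import Relation.Nullary using (¬_)
open import Relation.Binary.PropositionalEquality using (_≡_; _≢_)
open import Function.Bundles using (_⤖_; _⇔_; Bijection)

record Graph (n : ℕ) : Set₁ where
  field
    Adj     : Fin n → Fin n → Set
    irrefl  : ∀ {u} → ¬ Adj u u
    sym     : ∀ {u v} → Adj u v → Adj v u
open Graph public

data Walk {n : ℕ} (G : Graph n) : Fin n → Fin n → ℕ → Set where
  nil  : ∀ {u} → Walk G u u zero
  cons : ∀ {u w v k} → Adj G u w → Walk G w v k → Walk G u v (suc k)

Connected : ∀ {n} → Graph n → Set
Connected {n} G = ∀ (u v : Fin n) → ∃[ k ] Walk G u v k

-- d(v, S) ≡ k, for S given as a predicate on vertices:
-- some w ∈ S is reached by a walk of length k, and every walk from v to S has length ≥ k.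
SetDist : ∀ {n} → Graph n → Fin n → (Fin n → Set) → ℕ → Set
SetDist {n} G v S k =
  (∃[ w ] (S w × Walk G v w k)) × (∀ (w : Fin n) (m : ℕ) → S w → Walk G v w m → k ≤ m)

-- An ordered partition of V(G) into k (nonempty) classes, given by a surjective class map.
-- Class j is S_j = { w | f w ≡ j }.
Partition : ℕ → ℕ → Set
Partition n k = Σ (Fin n → Fin k) λ f → ∀ (j : Fin k) → ∃[ w ] f w ≡ j

Class : ∀ {n k} → Partition n k → Fin k → Fin n → Set
Class (f , _) j w = f w ≡ j

SameRep : ∀ {n k} → Graph n → Partition n k → Fin n → Fin n → Set
SameRep G P u v = ∀ j → ∃[ d ] (SetDist G u (Class P j) d × SetDist G v (Class P j) d)

Resolving : ∀ {n k} → Graph n → Partition n k → Set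
Resolving {n} G P = ∀ (u v : Fin n) → SameRep G P u v → u ≡ v

Dominating : ∀ {n k} → Graph n → Partition n k → Set
Dominating {n} {k} G P = ∀ (v : Fin n) → ∃[ j ] SetDist G v (Class P j) 1

ResDomPartition : ∀ {n} → Graph n → ℕ → Set
ResDomPartition {n} G k = Σ (Partition n k) λ P → Resolving G P × Dominating G P

EtaP : ∀ {n} → Graph n → ℕ → Set
EtaP G m = ResDomPartition G m × (∀ k → ResDomPartition G k → m ≤ k)

K : (m : ℕ) → Graph m
K m = record { Adj = λ u v → u ≢ v ; irrefl = λ p → p _≡_.refl ; sym = λ p q → p (Eq.sym q) }
  where import Relation.Binary.PropositionalEquality as Eq

_≅_ : ∀ {n m} → Graph n → Graph m → Set
_≅_ {n} {m} G H = Σ (Fin n ⤖ Fin m) λ φ →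
  ∀ (u v : Fin n) → Adj G u v ⇔ Adj H (Bijection.to φ u) (Bijection.to φ v)

module Submission where

-- The proof rests on three facts about an arbitrary partition Π = {S_j}:
--   * d(v, S_j) = 0 iff v ∈ S_j, so equal representations r(u|Π) = r(v|Π)
--     force u and v into the same class;
--   * d(v, S_j) = 1 means v ∉ S_j and v has a neighbour in S_j.
-- Lower bound: a dominating partition of a nonempty graph needs a class at
-- distance 1 from some vertex besides that vertex's own class, so it has
-- at least two classes.
-- (⇒) In a dominating partition {S₀, S₁} every vertex is at distance 1 from
-- the class it is not in, so two vertices of one class have the same
-- representation; resolvability then makes the class map injective, hence a
-- bijection onto Fin 2, and "different classes" means "adjacent".
-- (⇐) An isomorphism φ : G ≅ K₂ gives the partition into the singletons
-- {φ⁻¹(0)}, {φ⁻¹(1)}, which is resolving and dominating; with the lower bound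
-- this gives η_p(G) = 2.

open import Defs
open import Data.Nat using (ℕ; zero; suc; _≤_; z≤n; s≤s)
open import Data.Fin using (Fin) renaming (zero to fz; suc to fs)
open import Data.Product using (∃-syntax; _×_; _,_; proj₁; proj₂)
open import Data.Sum using (_⊎_; inj₁; inj₂)
open import Data.Empty using (⊥-elim)
open import Relation.Nullary using (¬_)
open import Relation.Binary.PropositionalEquality as ≡ using (_≡_; _≢_; refl; trans; subst)
open import Function.Bundles using (_⇔_; mk⇔; mk⤖; Bijection; Equivalence)
open import Function.Consequences.Propositional using (strictlySurjective⇒surjective)

classOf : ∀ {n k} → Partition n k → Fin n → Fin k
classOf = proj₁

module _ {n : ℕ} (G : Graph n) where

  member⇒dist0 : ∀ {S : Fin n → Set} {v} → S v → SetDist G v S 0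
  member⇒dist0 {v = v} s = (v , s , nil) , λ _ _ _ _ → z≤n

  dist0⇒member : ∀ {S : Fin n → Set} {v} → SetDist G v S 0 → S v
  dist0⇒member ((w , s , nil) , _) = s

  dist1⇒outside : ∀ {S : Fin n → Set} {v} → SetDist G v S 1 → ¬ S v
  dist1⇒outside {v = v} (_ , minimal) s with minimal v 0 s nil
  ... | ()

  dist1⇒neighbour : ∀ {S : Fin n → Set} {v} → SetDist G v S 1 → ∃[ w ] (S w × Adj G v w)
  dist1⇒neighbour ((w , s , cons a nil) , _) = w , s , a

  neighbour⇒dist1 : ∀ {S : Fin n → Set} {v w} → ¬ S v → S w → Adj G v w → SetDist G v S 1
  neighbour⇒dist1 {S} {v} {w} v∉S w∈S a = (w , w∈S , cons a nil) , atLeast1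
    where
    atLeast1 : ∀ x m → S x → Walk G v x m → 1 ≤ m
    atLeast1 x .0 x∈S nil = ⊥-elim (v∉S x∈S)
    atLeast1 x .(suc _) _ (cons _ _) = s≤s z≤n

  -- Equal representations force equal classes: the own-class coordinate of
  -- r(u|Π) is 0, so v is also at distance 0 from, i.e. inside, u's class.
  sameRep⇒sameClass : ∀ {k} (P : Partition n k) {u v} →
    SameRep G P u v → classOf P v ≡ classOf P u
  sameRep⇒sameClass P {u} {v} same with same (classOf P u)
  ... | d , (_ , minimal) , dv with minimal u 0 refl nil
  ... | z≤n = dist0⇒member dv

  injective⇒resolving : ∀ {k} (P : Partition n k) →
    (∀ {u v} → classOf P u ≡ classOf P v → u ≡ v) → Resolving G P
  injective⇒resolving P inj u v same = inj (≡.sym (sameRep⇒sameClass P same))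

  -- Every resolving dominating partition of a nonempty graph has at least two
  -- classes: the class at distance 1 from a vertex differs from its own.
  atLeastTwoClasses : Fin n → ∀ k → ResDomPartition G k → 2 ≤ k
  atLeastTwoClasses v zero ((f , _) , _) with f v
  ... | ()
  atLeastTwoClasses v (suc zero) (P , _ , dom) with dom v
  ... | fz , d = ⊥-elim (dist1⇒outside d (onlyClass (classOf P v)))
    where
    onlyClass : (x : Fin 1) → x ≡ fz
    onlyClass fz = refl
  atLeastTwoClasses v (suc (suc k)) _ = s≤s (s≤s z≤n)

other : Fin 2 → Fin 2
other fz = fs fz
other (fs fz) = fz

other-≢ : ∀ a → a ≢ other a
other-≢ fz ()
other-≢ (fs fz) ()

a-or-other : ∀ a j → j ≡ a ⊎ j ≡ other a
a-or-other fz fz = inj₁ refl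
a-or-other fz (fs fz) = inj₂ refl
a-or-other (fs fz) fz = inj₂ refl
a-or-other (fs fz) (fs fz) = inj₁ refl

≢⇒other : ∀ {a j : Fin 2} → j ≢ a → j ≡ other a
≢⇒other {a} {j} j≢a with a-or-other a j
... | inj₁ j≡a = ⊥-elim (j≢a j≡a)
... | inj₂ j≡other = j≡other

module DominatingBipartition {n : ℕ} (G : Graph n) (P : Partition n 2) (dom : Dominating G P) where

  f : Fin n → Fin 2
  f = classOf P

  otherClassDist1 : ∀ v → SetDist G v (Class P (other (f v))) 1
  otherClassDist1 v with dom v
  ... | j , d = subst (λ i → SetDist G v (Class P i) 1)
                      (≢⇒other (λ j≡fv → dist1⇒outside G d (≡.sym j≡fv))) d

  sameClass⇒sameRep : ∀ {u v} → f u ≡ f v → SameRep G P u v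
  sameClass⇒sameRep {u} {v} e j with a-or-other (f u) j
  ... | inj₁ refl = 0 , member⇒dist0 G refl , member⇒dist0 G (≡.sym e)
  ... | inj₂ refl = 1 , otherClassDist1 u
                      , subst (λ a → SetDist G v (Class P (other a)) 1) (≡.sym e) (otherClassDist1 v)

  module _ (res : Resolving G P) where

    classOf-injective : ∀ {u v} → f u ≡ f v → u ≡ v
    classOf-injective {u} {v} e = res u v (sameClass⇒sameRep e)

    -- Vertices in different classes are adjacent: u is adjacent to some
    -- vertex of the other class, which by injectivity is v.
    differentClass⇒adjacent : ∀ {u v} → f u ≢ f v → Adj G u v
    differentClass⇒adjacent {u} {v} ne with dist1⇒neighbour G (otherClassDist1 u)
    ... | w , fw≡other , a =
      subst (Adj G u) (classOf-injective (trans fw≡other (≡.sym (≢⇒other (λ e → ne (≡.sym e)))))) a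

    isoK₂ : G ≅ K 2
    isoK₂ = mk⤖ (classOf-injective , strictlySurjective⇒surjective (proj₂ P)) , adjacency
      where
      adjacency : ∀ u v → Adj G u v ⇔ Adj (K 2) (f u) (f v)
      adjacency u v = mk⇔ (λ a e → irrefl G (subst (Adj G u) (≡.sym (classOf-injective e)) a))
                          differentClass⇒adjacent

isoK₂⇒resDom : ∀ {n} (G : Graph n) → G ≅ K 2 → ResDomPartition G 2
isoK₂⇒resDom {n} G (φ , preservesAdj) = P , injective⇒resolving G P (Bijection.injective φ) , dom
  where
  f : Fin n → Fin 2
  f = Bijection.to φ

  P : Partition n 2
  P = f , Bijection.strictlySurjective φ

  -- v is adjacent to the preimage of the other vertex of K₂.
  dom : Dominating G P
  dom v with Bijection.strictlySurjective φ (other (f v))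
  ... | w , fw≡other = other (f v) , neighbour⇒dist1 G (other-≢ (f v)) fw≡other adj
    where
    adj : Adj G v w
    adj = Equivalence.from (preservesAdj v w) (λ e → other-≢ (f v) (trans e fw≡other))

mainTheorem8 : ∀ (n : ℕ) (G : Graph n) → Connected G → 2 ≤ n →
    EtaP G 2 ⇔ (G ≅ K 2)
mainTheorem8 zero G _ ()
mainTheorem8 (suc n) G _ _ = mk⇔ etaP2⇒K₂ K₂⇒etaP2
  where
  etaP2⇒K₂ : EtaP G 2 → G ≅ K 2
  etaP2⇒K₂ ((P , res , dom) , _) = DominatingBipartition.isoK₂ G P dom res

  K₂⇒etaP2 : G ≅ K 2 → EtaP G 2
  K₂⇒etaP2 iso = isoK₂⇒resDom G iso , atLeastTwoClasses G fz
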